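{- An AC algorithm makes no excessive queries (for any input partition) if and only if it is chordal.
   Context: AC algorithm: on a finite set $S$ with an unknown set partition $P$, it adaptively asks an oracle whether two items are in the same block. Aggregated graphs: $G_0$ is the edgeless graph on $S$; each query concerns two distinct non-adjacent vertices $x,y$ of the current aggregated graph $G_t$; a negative answer adds the edge $xy$; a positive answer merges $x,y$ into one vertex adjacent to all their neighbours, labelled by the union of their labels. The algorithm stops when the aggregated graph is complete. A query on vertices $x,y$ of the current aggregated graph $G_t$ is excessive if $x$ and $y$ are joined in $G_t$ by an induced path with an even number of vertices whose vertices alternate between two blocks of $P$. An AC algorithm is chordal if for every input partition every aggregated graph is chordal (all induced cycles have length $3$). -}

module Defs where

open import Data.Nat using (ℕ; zero; suc; _≤_; _+_; _%_)
open import Data.Nat.Properties using (_≟_)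
open import Data.Fin using (Fin; toℕ)
open import Data.Bool using (Bool; true; false)
open import Data.List using (List; []; _∷_; _++_)
open import Data.List.Membership.Propositional using (_∈_)
open import Data.Maybe using (Maybe; just; nothing; maybe)
open import Data.Product using (_×_; _,_; ∃; ∃-syntax)
open import Data.Sum using (_⊎_)
open import Relation.Nullary using (¬_; does)
open import Relation.Binary.PropositionalEquality using (_≡_; _≢_)
open import Function.Bundles using (_⇔_)

-- The ground set S is Fin n.  A set partition P of S is given by a block
-- labelling p : Fin n → ℕ (x, y in the same block iff p x ≡ p y); every
-- partition arises this way.
Partition : ℕ → Set
Partition n = Fin n → ℕ

-- A history: the queries asked so far (as pairs of items) with the
-- oracle answers (true = "same block").
History : ℕ → Set
History n = List (Fin n × Fin n × Bool)

-- Items merged into the same vertex of the aggregated graph: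
-- equivalence closure of the positively answered queries.
data Merged {n : ℕ} (h : History n) : Fin n → Fin n → Set where
  m-refl  : ∀ {a} → Merged h a a
  m-sym   : ∀ {a b} → Merged h a b → Merged h b a
  m-trans : ∀ {a b c} → Merged h a b → Merged h b c → Merged h a c
  m-pos   : ∀ {a b} → (a , b , true) ∈ h → Merged h a b

-- Adjacency of the vertices containing a and b in the aggregated graph:
-- some negatively answered query joined (items of) these two vertices.
Adj : ∀ {n} → History n → Fin n → Fin n → Set
Adj h a b = ∃[ c ] ∃[ d ] ((c , d , false) ∈ h ×
              ((Merged h c a × Merged h d b) ⊎ (Merged h c b × Merged h d a)))

Complete : ∀ {n} → History n → Set
Complete h = ∀ a b → ¬ Merged h a b → Adj h a b

ValidQuery : ∀ {n} → History n → Fin n → Fin n → Set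
ValidQuery h a b = ¬ Merged h a b × ¬ Adj h a b

Strategy : ℕ → Set
Strategy n = History n → Maybe (Fin n × Fin n)

answer : ∀ {n} → Partition n → Fin n → Fin n → Bool
answer p a b = does (p a ≟ p b)

step : ∀ {n} → Strategy n → Partition n → History n → History n
step s p h = maybe (λ { (a , b) → h ++ ((a , b , answer p a b) ∷ []) }) h (s h)

run : ∀ {n} → Strategy n → Partition n → ℕ → History n
run s p zero    = []
run s p (suc t) = step s p (run s p t)

StepOK : ∀ {n} → History n → Maybe (Fin n × Fin n) → Set
StepOK h nothing        = Complete h
StepOK h (just (a , b)) = ValidQuery h a b

record ACAlgorithm (n : ℕ) : Set where
  field
    next : Strategy n
    legal : ∀ (p : Partition n) (t : ℕ) → StepOK (run next p t) (next (run next p t))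
open ACAlgorithm public

PathNbr : ∀ {k} → Fin k → Fin k → Set
PathNbr i j = suc (toℕ i) ≡ toℕ j ⊎ suc (toℕ j) ≡ toℕ i

CycNbr : ∀ {k} → Fin k → Fin k → Set
CycNbr {k} i j = PathNbr i j ⊎ ((toℕ i ≡ 0 × suc (toℕ j) ≡ k) ⊎ (toℕ j ≡ 0 × suc (toℕ i) ≡ k))

-- An induced cycle of length k ≥ 4 in the aggregated graph of h,
-- whose i-th vertex is the vertex containing item v i.
InducedCycle≥4 : ∀ {n} → History n → (k : ℕ) → (Fin k → Fin n) → Set
InducedCycle≥4 h k v =
  4 ≤ k ×
  (∀ i j → i ≢ j → ¬ Merged h (v i) (v j)) ×
  (∀ i j → Adj h (v i) (v j) ⇔ CycNbr i j)

Chordal : ∀ {n} → History n → Set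
Chordal h = ∀ k (v : Fin k → _) → ¬ InducedCycle≥4 h k v

-- The query (a , b) asked at history h is excessive w.r.t. partition p:
-- the vertices of a and b are joined by an induced path with an even number
-- k of vertices, alternating between two (distinct) blocks β₁, β₂ of p.
Excessive : ∀ {n} → Partition n → History n → Fin n → Fin n → Set
Excessive {n} p h a b =
  ∃[ k ] ∃ λ (u : Fin k → Fin n) → (∃[ m ] (k ≡ m + m)) ×
    (∃[ i ] (toℕ i ≡ 0 × Merged h (u i) a)) ×
    (∃[ i ] (suc (toℕ i) ≡ k × Merged h (u i) b)) ×
    (∀ i j → i ≢ j → ¬ Merged h (u i) (u j)) ×
    (∀ i j → Adj h (u i) (u j) ⇔ PathNbr i j) ×
    (∃[ β₁ ] ∃[ β₂ ] (β₁ ≢ β₂ ×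
       (∀ (i : Fin k) c → Merged h c (u i) → toℕ i % 2 ≡ 0 → p c ≡ β₁) ×
       (∀ (i : Fin k) c → Merged h c (u i) → toℕ i % 2 ≡ 1 → p c ≡ β₂)))

NoExcessiveQueries : ∀ {n} → ACAlgorithm n → Set
NoExcessiveQueries {n} A =
  ∀ (p : Partition n) (t : ℕ) (a b : Fin n) →
    next A (run (next A) p t) ≡ just (a , b) → ¬ Excessive p (run (next A) p t) a b

ChordalAlg : ∀ {n} → ACAlgorithm n → Set
ChordalAlg {n} A = ∀ (p : Partition n) (t : ℕ) → Chordal (run (next A) p t)

-- Chordal ⇒ no excessive query: an excessive query joins the ends of an induced path with an even number
-- k ≥ 4 of vertices alternating between two blocks, so it is answered negatively and the new edge closes an
-- induced k-cycle.
--
-- No excessive query ⇒ chordal, by induction along the run. An induced cycle of length ≥ 4 created by a query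
-- (x, y) yields an induced path of length ≥ 4 between x and y in the previous graph: after a negative answer it is
-- the cycle minus the new edge; after a positive one the merged vertex is split back into x and y (unless one of
-- them alone already closes an induced cycle of the previous graph). If the path has an even number of vertices,
-- the query is excessive for the partition that 2-colours the path and keeps all other vertices apart. If odd,
-- answering the query against the partition whose blocks are the current vertices closes an odd induced cycle.
-- That partition makes every later answer negative, and since the algorithm must complete the graph, some later
-- query joins two vertices of the odd cycle; of the two arcs between them, the one with an even number of vertices
-- makes that query excessive.

module Submission where

open import Defs
open import Data.Nat using (ℕ; zero; suc; _≤_; _<_; _+_; _∸_; _*_; _%_; z≤n; s≤s)
import Data.Nat.Properties as ℕ
open import Data.Nat.DivMod using (m%n<n; %-distribˡ-+; m%n%n≡m%n; m<n⇒m%n≡m; [m+n]%n≡m%n; n%n≡0; m%n≤n)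
open import Data.Fin using (Fin; toℕ; fromℕ; fromℕ<; inject≤; opposite; combine) renaming (zero to fzero; suc to fsuc)
import Data.Fin.Properties as Fin
open import Data.Bool using (Bool; true; false)
open import Data.List using (List; _∷ʳ_)
open import Data.List.Membership.Propositional using (_∈_)
open import Data.List.Membership.Propositional.Properties using (∈-++⁺ʳ; ∈-++⁻)
open import Data.List.Relation.Binary.Subset.Propositional using (_⊆_)
open import Data.List.Relation.Binary.Subset.Propositional.Properties using (xs⊆xs++ys; ⊆-trans)
open import Data.List.Relation.Unary.Any using (here)
open import Data.Maybe using (just; nothing)
open import Data.Product using (_×_; _,_; ∃; ∃-syntax; proj₁; proj₂)
import Data.Sum
open import Data.Sum using (_⊎_; inj₁; inj₂; [_,_]; [_,_]′)
open import Data.Empty using (⊥; ⊥-elim)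
open import Relation.Nullary using (¬_; does; Dec; yes; no)
open import Relation.Nullary.Decidable using (dec-true; dec-false; ¬¬-excluded-middle)
open import Relation.Binary.Definitions using (tri<; tri≈; tri>; Decidable)
open import Relation.Binary.Structures using (IsEquivalence)
open import Relation.Binary.PropositionalEquality
  using (_≡_; _≢_; refl; sym; trans; cong; cong₂; subst; subst₂; module ≡-Reasoning)
open import Algebra.Properties.CommutativeSemigroup ℕ.+-commutativeSemigroup using (interchange)
open import Function using (_∘_; id)
open import Data.Vec.Functional using (_∷_; tail)
open import Function.Bundles using (_⇔_; mk⇔; Equivalence)
import Function.Properties.Equivalence as ⇔

private variable
  n : ℕ


-- Histories and aggregated graphs

∈-∷ʳ⁻ : ∀ {A : Set} {x y : A} (xs : List A) → x ∈ xs ∷ʳ y → x ∈ xs ⊎ x ≡ y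
∈-∷ʳ⁻ xs x∈ with ∈-++⁻ xs x∈
... | inj₁ x∈xs         = inj₁ x∈xs
... | inj₂ (here x≡y)   = inj₂ x≡y

∈-∷ʳ : ∀ {A : Set} (xs : List A) (x : A) → x ∈ xs ∷ʳ x
∈-∷ʳ xs x = ∈-++⁺ʳ xs (here refl)

-- Adj h c d unfolds to ∃ a b, (a , b , false) ∈ h × Joins h a b c d.
Joins : History n → Fin n → Fin n → Fin n → Fin n → Set
Joins h a b c d = (Merged h a c × Merged h b d) ⊎ (Merged h a d × Merged h b c)

module _ {h : History n} where

  Joins-sym : ∀ {a b c d} → Joins h a b c d → Joins h a b d c
  Joins-sym (inj₁ (ac , bd)) = inj₂ (ac , bd)
  Joins-sym (inj₂ (ad , bc)) = inj₁ (ad , bc)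

  Joins-resp-Merged : ∀ {a b c d c′ d′} → Merged h c c′ → Merged h d d′ → Joins h a b c d → Joins h a b c′ d′
  Joins-resp-Merged cc′ dd′ (inj₁ (ac , bd)) = inj₁ (m-trans ac cc′ , m-trans bd dd′)
  Joins-resp-Merged cc′ dd′ (inj₂ (ad , bc)) = inj₂ (m-trans ad dd′ , m-trans bc cc′)

  Adj-sym : ∀ {c d} → Adj h c d → Adj h d c
  Adj-sym (a , b , ab∈ , j) = a , b , ab∈ , Joins-sym j

  Adj-resp-Merged : ∀ {c d c′ d′} → Merged h c c′ → Merged h d d′ → Adj h c d → Adj h c′ d′
  Adj-resp-Merged cc′ dd′ (a , b , ab∈ , j) = a , b , ab∈ , Joins-resp-Merged cc′ dd′ j

  Adj-of-query : ∀ {a b} → (a , b , false) ∈ h → Adj h a b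
  Adj-of-query ab∈ = _ , _ , ab∈ , inj₁ (m-refl , m-refl)

module _ {h h′ : History n} (h⊆h′ : h ⊆ h′) where

  Merged-mono : ∀ {c d} → Merged h c d → Merged h′ c d
  Merged-mono m-refl         = m-refl
  Merged-mono (m-sym m)      = m-sym (Merged-mono m)
  Merged-mono (m-trans m m′) = m-trans (Merged-mono m) (Merged-mono m′)
  Merged-mono (m-pos e)      = m-pos (h⊆h′ e)

  Joins-mono : ∀ {a b c d} → Joins h a b c d → Joins h′ a b c d
  Joins-mono (inj₁ (ac , bd)) = inj₁ (Merged-mono ac , Merged-mono bd)
  Joins-mono (inj₂ (ad , bc)) = inj₂ (Merged-mono ad , Merged-mono bc)

  Adj-mono : ∀ {c d} → Adj h c d → Adj h′ c d
  Adj-mono (a , b , ab∈ , j) = a , b , h⊆h′ ab∈ , Joins-mono j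

⊆-∷ʳ : (h : History n) (e : Fin n × Fin n × Bool) → h ⊆ h ∷ʳ e
⊆-∷ʳ h e = xs⊆xs++ys h _

module _ {h : History n} {a b : Fin n} where

  private
    h⁻ = h ∷ʳ (a , b , false)

  Merged-∷ʳ-false⁻ : ∀ {c d} → Merged h⁻ c d → Merged h c d
  Merged-∷ʳ-false⁻ m-refl         = m-refl
  Merged-∷ʳ-false⁻ (m-sym m)      = m-sym (Merged-∷ʳ-false⁻ m)
  Merged-∷ʳ-false⁻ (m-trans m m′) = m-trans (Merged-∷ʳ-false⁻ m) (Merged-∷ʳ-false⁻ m′)
  Merged-∷ʳ-false⁻ (m-pos e)      with ∈-∷ʳ⁻ h e
  ... | inj₁ e∈h = m-pos e∈h

  Joins-∷ʳ-false⁻ : ∀ {a′ b′ c d} → Joins h⁻ a′ b′ c d → Joins h a′ b′ c d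
  Joins-∷ʳ-false⁻ (inj₁ (ac , bd)) = inj₁ (Merged-∷ʳ-false⁻ ac , Merged-∷ʳ-false⁻ bd)
  Joins-∷ʳ-false⁻ (inj₂ (ad , bc)) = inj₂ (Merged-∷ʳ-false⁻ ad , Merged-∷ʳ-false⁻ bc)

  Adj-∷ʳ-false⁻ : ∀ {c d} → Adj h⁻ c d → Adj h c d ⊎ Joins h a b c d
  Adj-∷ʳ-false⁻ (a′ , b′ , e , j) with ∈-∷ʳ⁻ h e
  ... | inj₁ e∈h  = inj₁ (a′ , b′ , e∈h , Joins-∷ʳ-false⁻ j)
  ... | inj₂ refl = inj₂ (Joins-∷ʳ-false⁻ j)

  Adj-∷ʳ-false⁺ : ∀ {c d} → Joins h a b c d → Adj h⁻ c d
  Adj-∷ʳ-false⁺ j = a , b , ∈-∷ʳ h _ , Joins-mono (⊆-∷ʳ h _) j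

module _ {h : History n} {x y : Fin n} where

  private
    h⁺ = h ∷ʳ (x , y , true)
    Merged⁺ : Fin n → Fin n → Set
    Merged⁺ c d = Merged h c d ⊎ Joins h x y c d

  Merged-∷ʳ-true⁻ : ∀ {c d} → Merged h⁺ c d → Merged h c d ⊎ Joins h x y c d
  Merged-∷ʳ-true⁻ m-refl         = inj₁ m-refl
  Merged-∷ʳ-true⁻ (m-sym m)      = sym⁺ (Merged-∷ʳ-true⁻ m)
    where
    sym⁺ : ∀ {c d} → Merged⁺ c d → Merged⁺ d c
    sym⁺ (inj₁ cd) = inj₁ (m-sym cd)
    sym⁺ (inj₂ j)  = inj₂ (Joins-sym j)
  Merged-∷ʳ-true⁻ (m-trans m m′) = trans⁺ (Merged-∷ʳ-true⁻ m) (Merged-∷ʳ-true⁻ m′)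
    where
    trans⁺ : ∀ {c d e} → Merged⁺ c d → Merged⁺ d e → Merged⁺ c e
    trans⁺ (inj₁ cd) (inj₁ de)                = inj₁ (m-trans cd de)
    trans⁺ (inj₁ cd) (inj₂ j)                 = inj₂ (Joins-resp-Merged (m-sym cd) m-refl j)
    trans⁺ (inj₂ j) (inj₁ de)                 = inj₂ (Joins-resp-Merged m-refl de j)
    trans⁺ (inj₂ (inj₁ (xc , yd))) (inj₂ (inj₁ (xd , ye))) = inj₂ (inj₁ (xc , ye))
    trans⁺ (inj₂ (inj₁ (xc , yd))) (inj₂ (inj₂ (xe , yd′))) = inj₁ (m-trans (m-sym xc) xe)
    trans⁺ (inj₂ (inj₂ (xd , yc))) (inj₂ (inj₁ (xd′ , ye))) = inj₁ (m-trans (m-sym yc) ye)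
    trans⁺ (inj₂ (inj₂ (xd , yc))) (inj₂ (inj₂ (xe , yd))) = inj₂ (inj₂ (xe , yc))
  Merged-∷ʳ-true⁻ (m-pos e)      with ∈-∷ʳ⁻ h e
  ... | inj₁ e∈h  = inj₁ (m-pos e∈h)
  ... | inj₂ refl = inj₂ (inj₁ (m-refl , m-refl))

  Merged-∷ʳ-true⁺ : Merged h⁺ x y
  Merged-∷ʳ-true⁺ = m-pos (∈-∷ʳ h _)

Joins⇒Adj : ∀ {h : History n} {a b c d} → Joins h a b c d → Adj h c d → Adj h a b
Joins⇒Adj (inj₁ (ac , bd)) cd = Adj-resp-Merged (m-sym ac) (m-sym bd) cd
Joins⇒Adj (inj₂ (ad , bc)) cd = Adj-sym (Adj-resp-Merged (m-sym bc) (m-sym ad) cd)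


-- Partitions consistent with a history

does-true⁻ : ∀ {A : Set} (a? : Dec A) → does a? ≡ true → A
does-true⁻ (yes a) _ = a

does-false⁻ : ∀ {A : Set} (a? : Dec A) → does a? ≡ false → ¬ A
does-false⁻ (no ¬a) _ = ¬a

answer-true⁻ : ∀ (p : Partition n) a b → answer p a b ≡ true → p a ≡ p b
answer-true⁻ p a b = does-true⁻ (p a ℕ.≟ p b)

answer-false⁻ : ∀ (p : Partition n) a b → answer p a b ≡ false → p a ≢ p b
answer-false⁻ p a b = does-false⁻ (p a ℕ.≟ p b)

answer-false⁺ : ∀ (p : Partition n) a b → p a ≢ p b → answer p a b ≡ false
answer-false⁺ p a b = dec-false (p a ℕ.≟ p b)

Consistent : Partition n → History n → Set
Consistent p h = ∀ {a b ans} → (a , b , ans) ∈ h → answer p a b ≡ ans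

module _ {p : Partition n} {h : History n} (consistent : Consistent p h) where

  Merged⇒same-block : ∀ {c d} → Merged h c d → p c ≡ p d
  Merged⇒same-block m-refl         = refl
  Merged⇒same-block (m-sym m)      = sym (Merged⇒same-block m)
  Merged⇒same-block (m-trans m m′) = trans (Merged⇒same-block m) (Merged⇒same-block m′)
  Merged⇒same-block (m-pos e)      = answer-true⁻ p _ _ (consistent e)

  Adj⇒different-block : ∀ {c d} → Adj h c d → p c ≢ p d
  Adj⇒different-block (a , b , e , inj₁ (ac , bd)) pc≡pd =
    answer-false⁻ p a b (consistent e) (trans (Merged⇒same-block ac) (trans pc≡pd (sym (Merged⇒same-block bd))))
  Adj⇒different-block (a , b , e , inj₂ (ad , bc)) pc≡pd =
    answer-false⁻ p a b (consistent e) (trans (Merged⇒same-block ad) (trans (sym pc≡pd) (sym (Merged⇒same-block bc))))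

  Merged⇒¬Adj : ∀ {c d} → Merged h c d → ¬ Adj h c d
  Merged⇒¬Adj m a = Adj⇒different-block a (Merged⇒same-block m)

blocks⇒consistent : ∀ {p : Partition n} {h : History n} →
  (∀ {c d} → Merged h c d → p c ≡ p d) → (∀ {c d} → Adj h c d → p c ≢ p d) → Consistent p h
blocks⇒consistent {p = p} same diff {a} {b} {true}  e = dec-true (p a ℕ.≟ p b) (same (m-pos e))
blocks⇒consistent {p = p} same diff {a} {b} {false} e = answer-false⁺ p a b (diff (Adj-of-query e))


-- Runs

module _ (s : Strategy n) (p : Partition n) where

  run-query : ∀ t {a b} → s (run s p t) ≡ just (a , b) → run s p (suc t) ≡ run s p t ∷ʳ (a , b , answer p a b)
  run-query t eq with s (run s p t)
  run-query t refl | just _ = refl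

  run-stop : ∀ t → s (run s p t) ≡ nothing → run s p (suc t) ≡ run s p t
  run-stop t eq with s (run s p t)
  run-stop t refl | nothing = refl

  run-⊆-suc : ∀ t → run s p t ⊆ run s p (suc t)
  run-⊆-suc t e∈ with s (run s p t)
  ... | nothing = e∈
  ... | just _  = ⊆-∷ʳ (run s p t) _ e∈

  run-mono : ∀ {t t′} → t ≤ t′ → run s p t ⊆ run s p t′
  run-mono {t′ = zero}   z≤n = id
  run-mono {t′ = suc t′} t≤  with ℕ.m≤n⇒m<n∨m≡n t≤
  ... | inj₁ (s≤s t≤t′) = run-⊆-suc t′ ∘ run-mono t≤t′
  ... | inj₂ refl       = id

  run-consistent : ∀ t → Consistent p (run s p t)
  run-consistent (suc t) e∈ with s (run s p t)
  ... | nothing = run-consistent t e∈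
  ... | just _  with ∈-∷ʳ⁻ (run s p t) e∈
  ...   | inj₁ e∈′ = run-consistent t e∈′
  ...   | inj₂ refl = refl

  consistent⇒run≡ : ∀ {p′} t → Consistent p′ (run s p t) → run s p′ t ≡ run s p t
  consistent⇒run≡ zero    _          = refl
  consistent⇒run≡ {p′} (suc t) consistent
    rewrite consistent⇒run≡ {p′} t (λ e∈ → consistent (run-⊆-suc t e∈)) with s (run s p t)
  ... | nothing     = refl
  ... | just (a , b) = cong (λ ans → run s p t ∷ʳ (a , b , ans)) (consistent (∈-∷ʳ (run s p t) _))


-- Parity

Even Odd : ℕ → Set
Even k = ∃[ m ] (k ≡ m + m)
Odd  k = ∃[ m ] (k ≡ suc (m + m))

odd⇒even-suc : ∀ {k} → Odd k → Even (suc k)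
odd⇒even-suc (m , k≡1+m+m) = suc m , cong suc (trans k≡1+m+m (sym (ℕ.+-suc m m)))

even⊎odd : ∀ k → Even k ⊎ Odd k
even⊎odd zero    = inj₁ (0 , refl)
even⊎odd (suc k) with even⊎odd k
... | inj₁ (m , k≡m+m) = inj₂ (m , cong suc k≡m+m)
... | inj₂ odd         = inj₁ (odd⇒even-suc odd)

¬even∧odd : ∀ {k} → Even k → ¬ Odd k
¬even∧odd (m , refl) (m′ , eq) = go m m′ eq
  where
  go : ∀ m m′ → m + m ≢ suc (m′ + m′)
  go (suc m) zero    eq = ℕ.1+n≢0 (trans (sym (ℕ.+-suc m m)) (ℕ.suc-injective eq))
  go (suc m) (suc m′) eq =
    go m m′ (ℕ.suc-injective (trans (sym (ℕ.+-suc m m)) (trans (ℕ.suc-injective eq) (cong suc (ℕ.+-suc m′ m′)))))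

even+even : ∀ {a b} → Even a → Even b → Even (a + b)
even+even (m , refl) (m′ , refl) = m + m′ , interchange m m m′ m′

odd-+⇒even-suc : ∀ a b → Odd (a + b) → Even (suc a) ⊎ Even (suc b)
odd-+⇒even-suc a b odd with even⊎odd a | even⊎odd b
... | inj₂ odd-a | _          = inj₁ (odd⇒even-suc odd-a)
... | inj₁ _     | inj₂ odd-b = inj₂ (odd⇒even-suc odd-b)
... | inj₁ even-a | inj₁ even-b = ⊥-elim (¬even∧odd (even+even even-a even-b) odd)

suc-suc-%2 : ∀ a → suc (suc a) % 2 ≡ a % 2
suc-suc-%2 a = trans (cong (_% 2) (ℕ.+-comm 2 a)) ([m+n]%n≡m%n a 2)

suc-%2≢ : ∀ a → suc a % 2 ≢ a % 2
suc-%2≢ (suc (suc a)) eq = suc-%2≢ a (trans (sym (suc-suc-%2 (suc a))) (trans eq (suc-suc-%2 a)))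

odd⇒%2≡1 : ∀ {a} → Odd a → a % 2 ≡ 1
odd⇒%2≡1 (zero  , refl) = refl
odd⇒%2≡1 (suc m , refl) =
  trans (cong (λ b → suc (suc b) % 2) (ℕ.+-suc m m)) (trans (suc-suc-%2 (suc (m + m))) (odd⇒%2≡1 (m , refl)))

even-suc⇒odd : ∀ {a} → Even (suc a) → Odd a
even-suc⇒odd {a} even with even⊎odd a
... | inj₂ odd   = odd
... | inj₁ (m , refl) = ⊥-elim (¬even∧odd even (m , refl))


-- Positions on paths and cycles

suc-toℕ-opposite : ∀ {k} (i : Fin k) → suc (toℕ (opposite i)) ≡ k ∸ toℕ i
suc-toℕ-opposite i = trans (cong suc (Fin.opposite-prop i)) (sym (ℕ.+-∸-assoc 1 (Fin.toℕ<n i)))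

opposite-injective : ∀ {k} {i j : Fin k} → opposite i ≡ opposite j → i ≡ j
opposite-injective {i = i} {j} eq =
  trans (sym (Fin.opposite-involutive i)) (trans (cong opposite eq) (Fin.opposite-involutive j))

opposite-PathNbr : ∀ {k} (i j : Fin k) → PathNbr (opposite i) (opposite j) ⇔ PathNbr i j
opposite-PathNbr {k} i j = mk⇔
  (Data.Sum.map (reflect i j) (reflect j i) ∘ Data.Sum.swap)
  (Data.Sum.swap ∘ Data.Sum.map (reflect′ i j) (reflect′ j i))
  where
  open ≡-Reasoning
  reflect : ∀ (i j : Fin k) → suc (toℕ (opposite j)) ≡ toℕ (opposite i) → suc (toℕ i) ≡ toℕ j
  reflect i j eq = sym (ℕ.∸-cancelˡ-≡ (ℕ.<⇒≤ (Fin.toℕ<n j)) (Fin.toℕ<n i) (begin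
    k ∸ toℕ j                    ≡⟨ suc-toℕ-opposite j ⟨
    suc (toℕ (opposite j))       ≡⟨ eq ⟩
    toℕ (opposite i)             ≡⟨ Fin.opposite-prop i ⟩
    k ∸ suc (toℕ i)              ∎))
  reflect′ : ∀ (i j : Fin k) → suc (toℕ i) ≡ toℕ j → suc (toℕ (opposite j)) ≡ toℕ (opposite i)
  reflect′ i j eq = begin
    suc (toℕ (opposite j))       ≡⟨ suc-toℕ-opposite j ⟩
    k ∸ toℕ j                    ≡⟨ cong (k ∸_) eq ⟨
    k ∸ suc (toℕ i)              ≡⟨ Fin.opposite-prop i ⟨
    toℕ (opposite i)             ∎

first-unique : ∀ {k} {i j : Fin k} → toℕ i ≡ 0 → toℕ j ≡ 0 → i ≡ j
first-unique i≡0 j≡0 = Fin.toℕ-injective (trans i≡0 (sym j≡0))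

last-unique : ∀ {k} {i j : Fin k} → suc (toℕ i) ≡ k → suc (toℕ j) ≡ k → i ≡ j
last-unique i-last j-last = Fin.toℕ-injective (ℕ.suc-injective (trans i-last (sym j-last)))

¬PathNbr-ends : ∀ {k} {i₀ i₁ : Fin k} → 3 ≤ k → toℕ i₀ ≡ 0 → suc (toℕ i₁) ≡ k → ¬ PathNbr i₀ i₁
¬PathNbr-ends 3≤k i₀≡0 i₁-last (inj₁ eq) =
  ℕ.<-irrefl refl (ℕ.≤-trans 3≤k (ℕ.≤-reflexive (trans (sym i₁-last) (cong suc (trans (sym eq) (cong suc i₀≡0))))))
¬PathNbr-ends 3≤k i₀≡0 i₁-last (inj₂ eq) = ℕ.1+n≢0 (trans eq i₀≡0)

module Rotation (K : ℕ) where

  private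
    L = suc K

  rotate : ℕ → Fin L → Fin L
  rotate r i = fromℕ< (m%n<n (r + toℕ i) L)

  toℕ-rotate : ∀ r i → toℕ (rotate r i) ≡ (r + toℕ i) % L
  toℕ-rotate r i = Fin.toℕ-fromℕ< _

  rotate-∘ : ∀ s r i → rotate s (rotate r i) ≡ rotate (s + r) i
  rotate-∘ s r i = Fin.toℕ-injective (begin
    toℕ (rotate s (rotate r i)) ≡⟨ toℕ-rotate s _ ⟩
    (s + toℕ (rotate r i)) % L  ≡⟨ cong (λ m → (s + m) % L) (toℕ-rotate r i) ⟩
    (s + (r + toℕ i) % L) % L   ≡⟨ %-distribˡ-+ s _ L ⟩
    (s % L + (r + toℕ i) % L % L) % L ≡⟨ cong (λ m → (s % L + m) % L) (m%n%n≡m%n (r + toℕ i) L) ⟩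
    (s % L + (r + toℕ i) % L) % L ≡⟨ %-distribˡ-+ s _ L ⟨
    (s + (r + toℕ i)) % L       ≡⟨ cong (_% L) (ℕ.+-assoc s r (toℕ i)) ⟨
    (s + r + toℕ i) % L         ≡⟨ toℕ-rotate (s + r) i ⟨
    toℕ (rotate (s + r) i)      ∎)
    where open ≡-Reasoning

  rotate-toℕ-comm : ∀ (i j : Fin L) → rotate (toℕ i) j ≡ rotate (toℕ j) i
  rotate-toℕ-comm i j = Fin.toℕ-injective
    (trans (toℕ-rotate (toℕ i) j) (trans (cong (_% L) (ℕ.+-comm (toℕ i) (toℕ j))) (sym (toℕ-rotate (toℕ j) i))))

  rotate-zero : ∀ i → rotate 0 i ≡ i
  rotate-zero i = Fin.toℕ-injective (trans (toℕ-rotate 0 i) (m<n⇒m%n≡m (Fin.toℕ<n i)))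

  rotate-at-zero : ∀ i → rotate (toℕ i) fzero ≡ i
  rotate-at-zero i = trans (rotate-toℕ-comm i fzero) (rotate-zero i)

  rotate-L : ∀ i → rotate L i ≡ i
  rotate-L i = Fin.toℕ-injective (begin
    toℕ (rotate L i)   ≡⟨ toℕ-rotate L i ⟩
    (L + toℕ i) % L    ≡⟨ cong (_% L) (ℕ.+-comm L (toℕ i)) ⟩
    (toℕ i + L) % L    ≡⟨ [m+n]%n≡m%n (toℕ i) L ⟩
    toℕ i % L          ≡⟨ m<n⇒m%n≡m (Fin.toℕ<n i) ⟩
    toℕ i              ∎)
    where open ≡-Reasoning

  rotate-% : ∀ r i → rotate (r % L) i ≡ rotate r i
  rotate-% r i = Fin.toℕ-injective (begin
    toℕ (rotate (r % L) i)    ≡⟨ toℕ-rotate (r % L) i ⟩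
    (r % L + toℕ i) % L       ≡⟨ cong (λ m → (r % L + m) % L) (m<n⇒m%n≡m (Fin.toℕ<n i)) ⟨
    (r % L + toℕ i % L) % L   ≡⟨ %-distribˡ-+ r (toℕ i) L ⟨
    (r + toℕ i) % L           ≡⟨ toℕ-rotate r i ⟨
    toℕ (rotate r i)          ∎)
    where open ≡-Reasoning

  rotate-cancel : ∀ r i → rotate (L ∸ r % L) (rotate r i) ≡ i
  rotate-cancel r i = begin
    rotate (L ∸ r % L) (rotate r i)         ≡⟨ cong (rotate (L ∸ r % L)) (rotate-% r i) ⟨
    rotate (L ∸ r % L) (rotate (r % L) i)   ≡⟨ rotate-∘ (L ∸ r % L) (r % L) i ⟩
    rotate (L ∸ r % L + r % L) i            ≡⟨ cong (λ m → rotate m i) (ℕ.m∸n+n≡m (m%n≤n r L)) ⟩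
    rotate L i                              ≡⟨ rotate-L i ⟩
    i                                       ∎
    where open ≡-Reasoning

  rotate-injective : ∀ r {i j} → rotate r i ≡ rotate r j → i ≡ j
  rotate-injective r {i} {j} eq =
    trans (sym (rotate-cancel r i)) (trans (cong (rotate (L ∸ r % L)) eq) (rotate-cancel r j))

  rotate-onto : ∀ (i j : Fin L) → rotate (toℕ i) (rotate (L ∸ toℕ i) j) ≡ j
  rotate-onto i j = trans (rotate-∘ (toℕ i) _ j)
    (trans (cong (λ m → rotate m j) (ℕ.m+[n∸m]≡n (ℕ.<⇒≤ (Fin.toℕ<n i)))) (rotate-L j))

  rotate-last : ∀ (i j : Fin L) → rotate 1 j ≡ i → rotate (toℕ i) (fromℕ K) ≡ j
  rotate-last i j eq = begin
    rotate (toℕ i) (fromℕ K)      ≡⟨ rotate-toℕ-comm i (fromℕ K) ⟩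
    rotate (toℕ (fromℕ K)) i      ≡⟨ cong₂ rotate (Fin.toℕ-fromℕ K) (sym eq) ⟩
    rotate K (rotate 1 j)         ≡⟨ rotate-∘ K 1 j ⟩
    rotate (K + 1) j              ≡⟨ cong (λ m → rotate m j) (ℕ.+-comm K 1) ⟩
    rotate L j                    ≡⟨ rotate-L j ⟩
    j                             ∎
    where open ≡-Reasoning

  rotate-complement : ∀ (i j d : Fin L) → rotate (toℕ i) d ≡ j → toℕ d ≢ 0 →
                      ∃[ d′ ] (rotate (toℕ j) d′ ≡ i × toℕ d + toℕ d′ ≡ L)
  rotate-complement i j d i+d≡j d≢0 =
    d′ , i-recovered , trans (cong (toℕ d +_) (Fin.toℕ-fromℕ< L∸d<L)) (ℕ.m+[n∸m]≡n d≤L)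
    where
    d≤L : toℕ d ≤ L
    d≤L = ℕ.<⇒≤ (Fin.toℕ<n d)
    L∸d<L : L ∸ toℕ d < L
    L∸d<L = ℕ.∸-monoʳ-< (ℕ.n≢0⇒n>0 d≢0) d≤L
    d′ : Fin L
    d′ = fromℕ< L∸d<L
    open ≡-Reasoning
    i-recovered : rotate (toℕ j) d′ ≡ i
    i-recovered = begin
      rotate (toℕ j) d′                    ≡⟨ rotate-toℕ-comm j d′ ⟩
      rotate (toℕ d′) j                    ≡⟨ cong (rotate (toℕ d′)) (trans (sym i+d≡j) (rotate-toℕ-comm i d)) ⟩
      rotate (toℕ d′) (rotate (toℕ d) i)   ≡⟨ rotate-∘ (toℕ d′) (toℕ d) i ⟩
      rotate (toℕ d′ + toℕ d) i            ≡⟨ cong (λ m → rotate (m + toℕ d) i) (Fin.toℕ-fromℕ< L∸d<L) ⟩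
      rotate (L ∸ toℕ d + toℕ d) i         ≡⟨ cong (λ m → rotate m i) (ℕ.m∸n+n≡m d≤L) ⟩
      rotate L i                           ≡⟨ rotate-L i ⟩
      i                                    ∎

  CycNbr⇔rotate-1 : ∀ (i j : Fin L) → CycNbr i j ⇔ (rotate 1 i ≡ j ⊎ rotate 1 j ≡ i)
  CycNbr⇔rotate-1 i j = mk⇔ to from
    where
    forward : ∀ (i j : Fin L) → suc (toℕ i) ≡ toℕ j → rotate 1 i ≡ j
    forward i j eq = Fin.toℕ-injective (trans (toℕ-rotate 1 i) (trans (cong (_% L) eq) (m<n⇒m%n≡m (Fin.toℕ<n j))))
    wrap : ∀ (i j : Fin L) → toℕ j ≡ 0 → suc (toℕ i) ≡ L → rotate 1 i ≡ j
    wrap i j j≡0 i≡last = Fin.toℕ-injective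
      (trans (toℕ-rotate 1 i) (trans (cong (_% L) i≡last) (trans (n%n≡0 L) (sym j≡0))))
    to : CycNbr i j → rotate 1 i ≡ j ⊎ rotate 1 j ≡ i
    to (inj₁ (inj₁ eq))        = inj₁ (forward i j eq)
    to (inj₁ (inj₂ eq))        = inj₂ (forward j i eq)
    to (inj₂ (inj₁ (i≡0 , j≡last))) = inj₂ (wrap j i i≡0 j≡last)
    to (inj₂ (inj₂ (j≡0 , i≡last))) = inj₁ (wrap i j j≡0 i≡last)
    unstep : ∀ (i j : Fin L) → rotate 1 i ≡ j → PathNbr i j ⊎ (toℕ j ≡ 0 × suc (toℕ i) ≡ L)
    unstep i j eq with ℕ.m≤n⇒m<n∨m≡n (Fin.toℕ<n i)
    ... | inj₁ i+1<L  = inj₁ (inj₁ (trans (sym (m<n⇒m%n≡m i+1<L)) (trans (sym (toℕ-rotate 1 i)) (cong toℕ eq))))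
    ... | inj₂ i+1≡L = inj₂ (trans (sym (cong toℕ eq))
                               (trans (toℕ-rotate 1 i) (trans (cong (_% L) i+1≡L) (n%n≡0 L))) , i+1≡L)
    from : rotate 1 i ≡ j ⊎ rotate 1 j ≡ i → CycNbr i j
    from (inj₁ eq) with unstep i j eq
    ... | inj₁ nbr = inj₁ nbr
    ... | inj₂ w   = inj₂ (inj₂ w)
    from (inj₂ eq) with unstep j i eq
    ... | inj₁ (inj₁ e) = inj₁ (inj₂ e)
    ... | inj₁ (inj₂ e) = inj₁ (inj₁ e)
    ... | inj₂ w        = inj₂ (inj₁ w)

  CycNbr-rotate : ∀ r (i j : Fin L) → CycNbr (rotate r i) (rotate r j) ⇔ CycNbr i j
  CycNbr-rotate r i j = mk⇔
    (λ nbr → Equivalence.from (CycNbr⇔rotate-1 i j)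
       (Data.Sum.map (λ eq → rotate-injective r (trans (sym (commute i)) eq))
                     (λ eq → rotate-injective r (trans (sym (commute j)) eq))
                     (Equivalence.to (CycNbr⇔rotate-1 _ _) nbr)))
    (λ nbr → Equivalence.from (CycNbr⇔rotate-1 _ _)
       (Data.Sum.map (λ eq → trans (commute i) (cong (rotate r) eq))
                     (λ eq → trans (commute j) (cong (rotate r) eq))
                     (Equivalence.to (CycNbr⇔rotate-1 i j) nbr)))
    where
    commute : ∀ i → rotate 1 (rotate r i) ≡ rotate r (rotate 1 i)
    commute i = trans (rotate-∘ 1 r i) (trans (cong (λ m → rotate m i) (ℕ.+-comm 1 r)) (sym (rotate-∘ r 1 i)))


-- Induced paths and cycles

Distinct : History n → ∀ {k} → (Fin k → Fin n) → Set
Distinct h u = ∀ i j → i ≢ j → ¬ Merged h (u i) (u j)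

InducedPath : History n → (k : ℕ) → (Fin k → Fin n) → Set
InducedPath h k u = Distinct h u × (∀ i j → Adj h (u i) (u j) ⇔ PathNbr i j)

InducedCycle : History n → (k : ℕ) → (Fin k → Fin n) → Set
InducedCycle h k u = Distinct h u × (∀ i j → Adj h (u i) (u j) ⇔ CycNbr i j)

-- The endpoint conditions are those of Excessive.
InducedPathBetween : History n → Fin n → Fin n → (k : ℕ) → (Fin k → Fin n) → Set
InducedPathBetween h a b k u =
  (∃[ i ] (toℕ i ≡ 0 × Merged h (u i) a)) × (∃[ i ] (suc (toℕ i) ≡ k × Merged h (u i) b)) × InducedPath h k u

Touches : History n → Fin n → ∀ {k} → (Fin k → Fin n) → Set
Touches h c v = ∃[ i ] Merged h c (v i)

Loopless : History n → Set
Loopless h = ∀ {c d} → Merged h c d → ¬ Adj h c d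

PathNbr-sym : ∀ {k} {i j : Fin k} → PathNbr i j → PathNbr j i
PathNbr-sym = Data.Sum.swap

CycNbr-sym : ∀ {k} {i j : Fin k} → CycNbr i j → CycNbr j i
CycNbr-sym = Data.Sum.map PathNbr-sym Data.Sum.swap

Distinct-∘ : ∀ {h : History n} {k m} {u : Fin k → Fin n} {f : Fin m → Fin k} →
  (∀ {i j} → f i ≡ f j → i ≡ j) → Distinct h u → Distinct h (u ∘ f)
Distinct-∘ f-injective distinct i j i≢j = distinct _ _ (i≢j ∘ f-injective)

module _ {h : History n} {k} {u : Fin k → Fin n} (distinct : Distinct h u) where

  Distinct⇒position-unique : ∀ {c i j} → Merged h (u i) c → Merged h (u j) c → i ≡ j
  Distinct⇒position-unique {i = i} {j} ui~c uj~c with i Fin.≟ j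
  ... | yes i≡j = i≡j
  ... | no  i≢j = ⊥-elim (distinct i j i≢j (m-trans ui~c (m-sym uj~c)))

  private
    same : ∀ {c i j} → Merged h c (u i) → Merged h c (u j) → i ≡ j
    same c~ui c~uj = Distinct⇒position-unique (m-sym c~ui) (m-sym c~uj)

  Joins-positions : ∀ {a b i₀ i₁ i j} → Joins h a b (u i₀) (u i₁) → Joins h a b (u i) (u j) →
                    (i ≡ i₀ × j ≡ i₁) ⊎ (i ≡ i₁ × j ≡ i₀)
  Joins-positions (inj₁ (a₀ , b₁)) (inj₁ (a , b)) = inj₁ (same a a₀ , same b b₁)
  Joins-positions (inj₁ (a₀ , b₁)) (inj₂ (a , b)) = inj₂ (same b b₁ , same a a₀)
  Joins-positions (inj₂ (a₁ , b₀)) (inj₁ (a , b)) = inj₂ (same a a₁ , same b b₀)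
  Joins-positions (inj₂ (a₁ , b₀)) (inj₂ (a , b)) = inj₁ (same b b₀ , same a a₁)

module _ {h : History n} where

  InducedPath-reverse : ∀ {k u} → InducedPath h k u → InducedPath h k (u ∘ opposite)
  InducedPath-reverse (distinct , adj) =
    Distinct-∘ opposite-injective distinct , λ i j → ⇔.trans (adj _ _) (opposite-PathNbr i j)

  InducedPathBetween-reverse : ∀ {a b k u} → InducedPathBetween h a b k u → InducedPathBetween h b a k (u ∘ opposite)
  InducedPathBetween-reverse {k = k} {u} ((i₀ , i₀≡0 , ua) , (i₁ , i₁≡last , ub) , path) =
    (opposite i₁ , first , subst (λ i → Merged h (u i) _) (sym (Fin.opposite-involutive i₁)) ub) ,
    (opposite i₀ , last , subst (λ i → Merged h (u i) _) (sym (Fin.opposite-involutive i₀)) ua) ,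
    InducedPath-reverse path
    where
    first : toℕ (opposite i₁) ≡ 0
    first = trans (Fin.opposite-prop i₁) (trans (cong (k ∸_) i₁≡last) (ℕ.n∸n≡0 k))
    last : suc (toℕ (opposite i₀)) ≡ k
    last = trans (suc-toℕ-opposite i₀) (cong (k ∸_) i₀≡0)

  InducedPathBetween-resp-Merged : ∀ {a b a′ b′ k u} → Merged h a a′ → Merged h b b′ →
    InducedPathBetween h a b k u → InducedPathBetween h a′ b′ k u
  InducedPathBetween-resp-Merged aa′ bb′ ((i₀ , i₀≡0 , ua) , (i₁ , i₁-last , ub) , path) =
    (i₀ , i₀≡0 , m-trans ua aa′) , (i₁ , i₁-last , m-trans ub bb′) , path

  InducedCycle⇒¬Complete : ∀ {M v} → InducedCycle h (4 + M) v → ¬ Complete h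
  InducedCycle⇒¬Complete {M} {v} (distinct , adj) complete =
    ¬nbr (Equivalence.to (adj v₀ v₂) (complete (v v₀) (v v₂) (distinct v₀ v₂ (λ ()))))
    where
    v₀ v₂ : Fin (4 + M)
    v₀ = fzero
    v₂ = fsuc (fsuc fzero)
    ¬nbr : ¬ CycNbr v₀ v₂
    ¬nbr (inj₁ (inj₁ ()))
    ¬nbr (inj₁ (inj₂ ()))
    ¬nbr (inj₂ (inj₁ (_ , ())))
    ¬nbr (inj₂ (inj₂ (() , _)))

  InducedCycle-rotate : ∀ {K} r {v} → InducedCycle h (suc K) v → InducedCycle h (suc K) (v ∘ Rotation.rotate K r)
  InducedCycle-rotate {K} r (distinct , adj) =
    Distinct-∘ (rotate-injective r) distinct , λ i j → ⇔.trans (adj _ _) (CycNbr-rotate r i j)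
    where open Rotation K

  InducedCycle⇒InducedPath-prefix : ∀ {m L v} (m<L : m < L) → InducedCycle h L v →
    InducedPath h m (v ∘ λ e → inject≤ e (ℕ.<⇒≤ m<L))
  InducedCycle⇒InducedPath-prefix {m} {L} m<L (distinct , adj) =
    Distinct-∘ inject-injective distinct , λ i j → ⇔.trans (adj _ _) (CycNbr-inject i j)
    where
    inject : Fin m → Fin L
    inject e = inject≤ e (ℕ.<⇒≤ m<L)
    toℕ-inject : ∀ e → toℕ (inject e) ≡ toℕ e
    toℕ-inject e = Fin.toℕ-inject≤ e _
    inject-injective : ∀ {i j} → inject i ≡ inject j → i ≡ j
    inject-injective {i} {j} eq = Fin.toℕ-injective (trans (sym (toℕ-inject i)) (trans (cong toℕ eq) (toℕ-inject j)))
    not-last : ∀ e → suc (toℕ (inject e)) ≢ L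
    not-last e eq = ℕ.<-irrefl eq (ℕ.<-≤-trans (s≤s (subst (_< m) (sym (toℕ-inject e)) (Fin.toℕ<n e))) m<L)
    PathNbr-inject : ∀ i j → PathNbr (inject i) (inject j) ⇔ PathNbr i j
    PathNbr-inject i j rewrite toℕ-inject i | toℕ-inject j = ⇔.refl
    CycNbr-inject : ∀ i j → CycNbr (inject i) (inject j) ⇔ PathNbr i j
    CycNbr-inject i j = mk⇔
      [ Equivalence.to (PathNbr-inject i j) , [ (λ (_ , j-last) → ⊥-elim (not-last j j-last))
                                              , (λ (_ , i-last) → ⊥-elim (not-last i i-last)) ] ]
      (inj₁ ∘ Equivalence.from (PathNbr-inject i j))

  InducedCycle⇒arc : ∀ {K w} → InducedCycle h (suc K) w → (d : Fin (suc K)) → ¬ Adj h (w d) (w fzero) →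
    ∃ (InducedPathBetween h (w fzero) (w d) (suc (toℕ d)))
  InducedCycle⇒arc {K} {w} cycle d d≁0 with ℕ.m≤n⇒m<n∨m≡n (Fin.toℕ<n d)
  ... | inj₂ d-last = ⊥-elim (d≁0 (Equivalence.from (proj₂ cycle d fzero) (inj₂ (inj₂ (refl , d-last)))))
  ... | inj₁ d<K = _ , (fzero , refl , m-refl) , (fromℕ (toℕ d) , cong suc (Fin.toℕ-fromℕ (toℕ d)) , end) ,
                   InducedCycle⇒InducedPath-prefix d<K cycle
    where
    end : Merged h (w (inject≤ (fromℕ (toℕ d)) (ℕ.<⇒≤ d<K))) (w d)
    end = subst (λ i → Merged h (w i) (w d))
            (Fin.toℕ-injective (sym (trans (Fin.toℕ-inject≤ _ _) (Fin.toℕ-fromℕ (toℕ d))))) m-refl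

module _ {h : History n} {a b : Fin n} where

  private
    h⁻ = h ∷ʳ (a , b , false)

  InducedPathBetween⇒InducedCycle : ∀ {k u} → InducedPathBetween h a b k u → InducedCycle h⁻ k u
  InducedPathBetween⇒InducedCycle {k} {u} ((i₀ , i₀≡0 , ua) , (i₁ , i₁-last , ub) , distinct , adj) =
    (λ i j i≢j → distinct i j i≢j ∘ Merged-∷ʳ-false⁻) , λ i j → mk⇔ (to i j) (from i j)
    where
    ends : Joins h a b (u i₀) (u i₁)
    ends = inj₁ (m-sym ua , m-sym ub)
    to : ∀ i j → Adj h⁻ (u i) (u j) → CycNbr i j
    to i j uiuj with Adj-∷ʳ-false⁻ uiuj
    ... | inj₁ uiuj′ = inj₁ (Equivalence.to (adj i j) uiuj′)
    ... | inj₂ joins with Joins-positions distinct ends joins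
    ...   | inj₁ (refl , refl) = inj₂ (inj₁ (i₀≡0 , i₁-last))
    ...   | inj₂ (refl , refl) = inj₂ (inj₂ (i₀≡0 , i₁-last))
    from : ∀ i j → CycNbr i j → Adj h⁻ (u i) (u j)
    from i j (inj₁ nbr) = Adj-mono (⊆-∷ʳ h _) (Equivalence.from (adj i j) nbr)
    from i j (inj₂ (inj₁ (i≡0 , j-last)))
      rewrite first-unique i≡0 i₀≡0 | last-unique j-last i₁-last = Adj-∷ʳ-false⁺ ends
    from i j (inj₂ (inj₂ (j≡0 , i-last)))
      rewrite first-unique j≡0 i₀≡0 | last-unique i-last i₁-last = Adj-∷ʳ-false⁺ (Joins-sym ends)

  InducedCycle⇒InducedPath : ∀ {k u} {i₀ i₁ : Fin k} → 3 ≤ k → ¬ Adj h a b → toℕ i₀ ≡ 0 → suc (toℕ i₁) ≡ k →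
    Joins h a b (u i₀) (u i₁) → InducedCycle h⁻ k u → InducedPath h k u
  InducedCycle⇒InducedPath {k} {u} {i₀} {i₁} 3≤k a≁b i₀≡0 i₁-last ends (distinct⁻ , adj) =
    distinct , λ i j → mk⇔ (to i j) (from i j)
    where
    distinct : Distinct h u
    distinct i j i≢j = distinct⁻ i j i≢j ∘ Merged-mono (⊆-∷ʳ h _)
    to : ∀ i j → Adj h (u i) (u j) → PathNbr i j
    to i j uiuj with Equivalence.to (adj i j) (Adj-mono (⊆-∷ʳ h _) uiuj)
    ... | inj₁ nbr = nbr
    ... | inj₂ (inj₁ (i≡0 , j-last))
      rewrite first-unique i≡0 i₀≡0 | last-unique j-last i₁-last = ⊥-elim (a≁b (Joins⇒Adj ends uiuj))
    ... | inj₂ (inj₂ (j≡0 , i-last))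
      rewrite first-unique j≡0 i₀≡0 | last-unique i-last i₁-last = ⊥-elim (a≁b (Joins⇒Adj ends (Adj-sym uiuj)))
    from : ∀ i j → PathNbr i j → Adj h (u i) (u j)
    from i j nbr with Adj-∷ʳ-false⁻ (Equivalence.from (adj i j) (inj₁ nbr))
    ... | inj₁ uiuj = uiuj
    ... | inj₂ joins with Joins-positions distinct ends joins
    ...   | inj₁ (refl , refl) = ⊥-elim (¬PathNbr-ends 3≤k i₀≡0 i₁-last nbr)
    ...   | inj₂ (refl , refl) = ⊥-elim (¬PathNbr-ends 3≤k i₀≡0 i₁-last (PathNbr-sym nbr))

  InducedCycle-∷ʳ-false-off : ∀ {k v} → ¬ Touches h a v ⊎ ¬ Touches h b v → InducedCycle h⁻ k v ⇔ InducedCycle h k v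
  InducedCycle-∷ʳ-false-off {k} {v} off = mk⇔
    (λ (distinct , adj) → (λ i j i≢j → distinct i j i≢j ∘ Merged-mono (⊆-∷ʳ h _)) ,
                          λ i j → ⇔.trans (Adj⇔ i j) (adj i j))
    (λ (distinct , adj) → (λ i j i≢j → distinct i j i≢j ∘ Merged-∷ʳ-false⁻) ,
                          λ i j → ⇔.trans (⇔.sym (Adj⇔ i j)) (adj i j))
    where
    ¬joins : ∀ {i j} → ¬ Joins h a b (v i) (v j)
    ¬joins {i} {j} (inj₁ (av , bv)) = [ (λ ¬a → ¬a (i , av)) , (λ ¬b → ¬b (j , bv)) ] off
    ¬joins {i} {j} (inj₂ (av , bv)) = [ (λ ¬a → ¬a (j , av)) , (λ ¬b → ¬b (i , bv)) ] off
    Adj⇔ : ∀ i j → Adj h (v i) (v j) ⇔ Adj h⁻ (v i) (v j)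
    Adj⇔ i j = mk⇔ (Adj-mono (⊆-∷ʳ h _)) ([ (λ vivj → vivj) , ⊥-elim ∘ ¬joins ] ∘ Adj-∷ʳ-false⁻)

InducedPath-cons : ∀ {h : History n} {k u d} → Loopless h → InducedPath h k u →
  (∀ i → ¬ Merged h d (u i)) → (∀ i → Adj h d (u i) ⇔ toℕ i ≡ 0) → InducedPath h (suc k) (d ∷ u)
InducedPath-cons {h = h} {k} {u} {d} loopless (distinct , adj) d≉u d~u = distinct′ , adj′
  where
  distinct′ : Distinct h (d ∷ u)
  distinct′ fzero    fzero    0≢0 = ⊥-elim (0≢0 refl)
  distinct′ fzero    (fsuc j) _   = d≉u j
  distinct′ (fsuc i) fzero    _   = d≉u i ∘ m-sym
  distinct′ (fsuc i) (fsuc j) i≢j = distinct i j (i≢j ∘ cong fsuc)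
  first : ∀ j → toℕ j ≡ 0 ⇔ PathNbr {suc k} fzero (fsuc j)
  first j = mk⇔ (λ j≡0 → inj₁ (cong suc (sym j≡0))) [ sym ∘ ℕ.suc-injective , (λ ()) ]
  shift : ∀ i j → PathNbr i j ⇔ PathNbr (fsuc i) (fsuc j)
  shift i j = mk⇔ (Data.Sum.map (cong suc) (cong suc)) (Data.Sum.map ℕ.suc-injective ℕ.suc-injective)
  adj′ : ∀ i j → Adj h ((d ∷ u) i) ((d ∷ u) j) ⇔ PathNbr i j
  adj′ fzero    fzero    = mk⇔ (⊥-elim ∘ loopless m-refl) [ (λ ()) , (λ ()) ]
  adj′ fzero    (fsuc j) = ⇔.trans (d~u j) (first j)
  adj′ (fsuc i) fzero    =
    ⇔.trans (mk⇔ Adj-sym Adj-sym) (⇔.trans (d~u i) (⇔.trans (first i) (mk⇔ PathNbr-sym PathNbr-sym)))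
  adj′ (fsuc i) (fsuc j) = ⇔.trans (adj i j) (shift i j)

even-InducedPathBetween⇒4≤ : ∀ {h : History n} {a b k u} →
  ¬ Adj h a b → InducedPathBetween h a b k u → Even k → 4 ≤ k
even-InducedPathBetween⇒4≤ a≁b ((() , _) , _) (zero , refl)
even-InducedPathBetween⇒4≤ a≁b ((i₀ , i₀≡0 , ua) , (i₁ , i₁-last , ub) , _ , adj) (suc zero , refl) =
  ⊥-elim (a≁b (Adj-resp-Merged ua ub
    (Equivalence.from (adj i₀ i₁) (inj₁ (trans (cong suc i₀≡0) (sym (ℕ.suc-injective i₁-last)))))))
even-InducedPathBetween⇒4≤ a≁b _ (suc (suc m) , refl) =
  s≤s (s≤s (ℕ.≤-trans (s≤s (s≤s z≤n)) (ℕ.m≤n+m (suc (suc m)) m)))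


-- Partitions realising a history

¬¬-Π-Fin : ∀ {k} {P : Fin k → Set} → (∀ i → ¬ ¬ P i) → ¬ ¬ (∀ i → P i)
¬¬-Π-Fin {zero}      _   ¬all = ¬all (λ ())
¬¬-Π-Fin {suc k} {P} ¬¬P ¬all =
  ¬¬P fzero λ p₀ → ¬¬-Π-Fin (¬¬P ∘ fsuc) λ ps → ¬all λ { fzero → p₀ ; (fsuc i) → ps i }

-- Decidability of Merged h is only ever needed inside proofs of ⊥, so its double negation suffices.
¬¬-Merged-decidable : (h : History n) → ¬ ¬ Decidable (Merged h)
¬¬-Merged-decidable h = ¬¬-Π-Fin λ c → ¬¬-Π-Fin λ d → ¬¬-excluded-middle

Merged-isEquivalence : (h : History n) → IsEquivalence (Merged h)
Merged-isEquivalence h = record { refl = m-refl ; sym = m-sym ; trans = m-trans }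

firstTrue : ∀ {m} → (Fin m → Bool) → ℕ
firstTrue {zero}  f = 0
firstTrue {suc m} f with f fzero
... | true  = 0
... | false = suc (firstTrue (f ∘ fsuc))

firstTrue-cong : ∀ {m} {f g : Fin m → Bool} → (∀ i → f i ≡ g i) → firstTrue f ≡ firstTrue g
firstTrue-cong {zero}          f≗g = refl
firstTrue-cong {suc m} {f} {g} f≗g with f fzero | g fzero | f≗g fzero
... | true  | true  | _ = refl
... | false | false | _ = cong suc (firstTrue-cong (f≗g ∘ fsuc))

firstTrue-true : ∀ {m} (f : Fin m → Bool) i → f i ≡ true → ∃[ j ] (toℕ j ≡ firstTrue f × f j ≡ true)
firstTrue-true {suc m} f i fi with f fzero in f₀
... | true  = fzero , refl , f₀
firstTrue-true {suc m} f fzero    fi | false with () ← trans (sym f₀) fi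
firstTrue-true {suc m} f (fsuc i) fi | false with firstTrue-true (f ∘ fsuc) i fi
... | j , j≡first , fj = fsuc j , cong suc j≡first , fj

module ClassIndex {_∼_ : Fin n → Fin n → Set} (isEquivalence : IsEquivalence _∼_) (_∼?_ : Decidable _∼_) where

  open IsEquivalence isEquivalence renaming (refl to ∼-refl; sym to ∼-sym; trans to ∼-trans)

  classIndex : Fin n → ℕ
  classIndex c = firstTrue (λ d → does (c ∼? d))

  classIndex-cong : ∀ {c c′} → c ∼ c′ → classIndex c ≡ classIndex c′
  classIndex-cong {c} {c′} c∼c′ = firstTrue-cong same
    where
    same : ∀ d → does (c ∼? d) ≡ does (c′ ∼? d)
    same d with c ∼? d | c′ ∼? d
    ... | yes _   | yes _    = refl
    ... | no  _   | no  _    = refl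
    ... | yes c∼d | no c′≁d  = ⊥-elim (c′≁d (∼-trans (∼-sym c∼c′) c∼d))
    ... | no  c≁d | yes c′∼d = ⊥-elim (c≁d (∼-trans c∼c′ c′∼d))

  classIndex-injective : ∀ {c c′} → classIndex c ≡ classIndex c′ → c ∼ c′
  classIndex-injective {c} {c′} eq
    with firstTrue-true (λ d → does (c ∼? d)) c (dec-true (c ∼? c) ∼-refl)
       | firstTrue-true (λ d → does (c′ ∼? d)) c′ (dec-true (c′ ∼? c′) ∼-refl)
  ... | j , j≡ , c∼j | j′ , j′≡ , c′∼j′ with Fin.toℕ-injective (trans j≡ (trans eq (sym j′≡)))
  ... | refl = ∼-trans (does-true⁻ (c ∼? j) c∼j) (∼-sym (does-true⁻ (c′ ∼? j) c′∼j′))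

module _ {h : History n} (merged? : Decidable (Merged h)) where

  open ClassIndex (Merged-isEquivalence h) merged?

  vertexPartition : Partition n
  vertexPartition = classIndex

  vertexPartition-separates : ∀ {a b} → ¬ Merged h a b → answer vertexPartition a b ≡ false
  vertexPartition-separates a≉b = answer-false⁺ vertexPartition _ _ (a≉b ∘ classIndex-injective)

  vertexPartition-consistent : Loopless h → Consistent vertexPartition h
  vertexPartition-consistent loopless =
    blocks⇒consistent classIndex-cong (λ cd eq → loopless (classIndex-injective eq) cd)

  module _ {k} (u : Fin k → Fin n) (distinct : Distinct h u) where

    pathPartition : Partition n
    pathPartition c with Fin.any? (λ i → merged? c (u i))
    ... | yes (i , _) = toℕ i % 2
    ... | no  _       = 2 + classIndex c

    pathPartition-on : ∀ {c i} → Merged h c (u i) → pathPartition c ≡ toℕ i % 2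
    pathPartition-on {c} {i} c~ui with Fin.any? (λ i → merged? c (u i))
    ... | yes (j , c~uj) = cong (λ i → toℕ i % 2) (Distinct⇒position-unique distinct (m-sym c~uj) (m-sym c~ui))
    ... | no  ¬touch     = ⊥-elim (¬touch (i , c~ui))

    pathPartition-off : ∀ {c} → ¬ Touches h c u → pathPartition c ≡ 2 + classIndex c
    pathPartition-off {c} ¬touch with Fin.any? (λ i → merged? c (u i))
    ... | yes touch = ⊥-elim (¬touch touch)
    ... | no  _     = refl

    pathPartition-cong : ∀ {c d} → Merged h c d → pathPartition c ≡ pathPartition d
    pathPartition-cong {c} {d} c~d with Fin.any? (λ i → merged? c (u i))
    ... | yes (i , c~ui) = sym (pathPartition-on (m-trans (m-sym c~d) c~ui))
    ... | no  ¬touch     =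
      sym (trans (pathPartition-off (λ (i , d~ui) → ¬touch (i , m-trans c~d d~ui))) (cong (2 +_) (sym (classIndex-cong c~d))))

    pathPartition-consistent : Loopless h → (∀ i j → Adj h (u i) (u j) → PathNbr i j) → Consistent pathPartition h
    pathPartition-consistent loopless path-adj = blocks⇒consistent pathPartition-cong different
      where
      %2≢2+ : ∀ a c → a % 2 ≢ 2 + classIndex c
      %2≢2+ a c eq = ℕ.<⇒≱ (m%n<n a 2) (subst (2 ≤_) (sym eq) (s≤s (s≤s z≤n)))
      different : ∀ {c d} → Adj h c d → pathPartition c ≢ pathPartition d
      different {c} {d} cd with Fin.any? (λ i → merged? c (u i)) | Fin.any? (λ i → merged? d (u i))
      ... | yes (i , c~ui) | yes (j , d~uj) = [ (λ eq pc≡pd → suc-%2≢ (toℕ i) (trans (cong (_% 2) eq) (sym pc≡pd)))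
                                              , (λ eq pc≡pd → suc-%2≢ (toℕ j) (trans (cong (_% 2) eq) pc≡pd)) ]
                                              (path-adj i j (Adj-resp-Merged c~ui d~uj cd))
      ... | yes (i , _) | no _ = %2≢2+ (toℕ i) d
      ... | no _ | yes (j , _) = %2≢2+ (toℕ j) c ∘ sym
      ... | no _ | no _        = λ eq → loopless (classIndex-injective (ℕ.suc-injective (ℕ.suc-injective eq))) cd


-- Merging the endpoints of a query

module Merge {h : History n} {x y : Fin n} (x≉y : ¬ Merged h x y) (x≁y : ¬ Adj h x y) (loopless : Loopless h) where

  private
    h⁺ = h ∷ʳ (x , y , true)

  Merged-∷ʳ-true-off : ∀ {c e} → ¬ Merged h⁺ x c → Merged h⁺ e c → Merged h e c
  Merged-∷ʳ-true-off x≉c e~c with Merged-∷ʳ-true⁻ e~c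
  ... | inj₁ e~c′               = e~c′
  ... | inj₂ (inj₁ (_ , y~c))   = ⊥-elim (x≉c (m-trans Merged-∷ʳ-true⁺ (Merged-mono (⊆-∷ʳ h _) y~c)))
  ... | inj₂ (inj₂ (x~c , _))   = ⊥-elim (x≉c (Merged-mono (⊆-∷ʳ h _) x~c))

  Merged-∷ʳ-true-on : ∀ {e} → Merged h⁺ e x → Merged h e x ⊎ Merged h e y
  Merged-∷ʳ-true-on e~x with Merged-∷ʳ-true⁻ e~x
  ... | inj₁ e~x′             = inj₁ e~x′
  ... | inj₂ (inj₁ (x~e , _)) = inj₁ (m-sym x~e)
  ... | inj₂ (inj₂ (_ , y~e)) = inj₂ (m-sym y~e)

  private
    ∈-∷ʳ-true⁻ : ∀ {e f} → (e , f , false) ∈ h⁺ → (e , f , false) ∈ h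
    ∈-∷ʳ-true⁻ ef∈ with ∈-∷ʳ⁻ h ef∈
    ... | inj₁ ef∈h = ef∈h

  Adj-∷ʳ-true-off : ∀ {c d} → ¬ Merged h⁺ x c → ¬ Merged h⁺ x d → Adj h⁺ c d → Adj h c d
  Adj-∷ʳ-true-off x≉c x≉d (e , f , ef∈ , inj₁ (e~c , f~d)) =
    e , f , ∈-∷ʳ-true⁻ ef∈ , inj₁ (Merged-∷ʳ-true-off x≉c e~c , Merged-∷ʳ-true-off x≉d f~d)
  Adj-∷ʳ-true-off x≉c x≉d (e , f , ef∈ , inj₂ (e~d , f~c)) =
    e , f , ∈-∷ʳ-true⁻ ef∈ , inj₂ (Merged-∷ʳ-true-off x≉d e~d , Merged-∷ʳ-true-off x≉c f~c)

  Adj-∷ʳ-true-on : ∀ {c d} → Merged h⁺ x c → ¬ Merged h⁺ x d → Adj h⁺ c d → Adj h x d ⊎ Adj h y d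
  Adj-∷ʳ-true-on x~c x≉d (e , f , ef∈ , inj₁ (e~c , f~d)) =
    Data.Sum.map (λ e~x → e , f , ef∈′ , inj₁ (e~x , f~d′)) (λ e~y → e , f , ef∈′ , inj₁ (e~y , f~d′))
      (Merged-∷ʳ-true-on (m-trans e~c (m-sym x~c)))
    where
    ef∈′ = ∈-∷ʳ-true⁻ ef∈
    f~d′ = Merged-∷ʳ-true-off x≉d f~d
  Adj-∷ʳ-true-on x~c x≉d (e , f , ef∈ , inj₂ (e~d , f~c)) =
    Data.Sum.map (λ f~x → e , f , ef∈′ , inj₂ (e~d′ , f~x)) (λ f~y → e , f , ef∈′ , inj₂ (e~d′ , f~y))
      (Merged-∷ʳ-true-on (m-trans f~c (m-sym x~c)))
    where
    ef∈′ = ∈-∷ʳ-true⁻ ef∈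
    e~d′ = Merged-∷ʳ-true-off x≉d e~d

  InducedCycle-∷ʳ-true-off : ∀ {k v} → ¬ Touches h⁺ x v → InducedCycle h⁺ k v → InducedCycle h k v
  InducedCycle-∷ʳ-true-off ¬touch (distinct , adj) =
    (λ i j i≢j → distinct i j i≢j ∘ Merged-mono (⊆-∷ʳ h _)) ,
    λ i j → mk⇔ (Equivalence.to (adj i j) ∘ Adj-mono (⊆-∷ʳ h _))
                (Adj-∷ʳ-true-off (λ x~vi → ¬touch (i , x~vi)) (λ x~vj → ¬touch (j , x~vj)) ∘ Equivalence.from (adj i j))

  module _ {M} {w : Fin (4 + M) → Fin n} (cycle : InducedCycle h⁺ (4 + M) w) (x~w₀ : Merged h⁺ x (w fzero)) where

    private
      k = 4 + M
      first last : Fin k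
      first = fsuc fzero
      last  = fromℕ (3 + M)
      distinct = proj₁ cycle
      adj = proj₂ cycle

    y~w₀ : Merged h⁺ y (w fzero)
    y~w₀ = m-trans (m-sym Merged-∷ʳ-true⁺) x~w₀

    x≉tail : ∀ e → ¬ Merged h⁺ x (w (fsuc e))
    x≉tail e x~we = distinct fzero (fsuc e) (λ ()) (m-trans (m-sym x~w₀) x~we)

    private
      head-CycNbr : ∀ e → CycNbr fzero (fsuc e) → fsuc e ≡ first ⊎ fsuc e ≡ last
      head-CycNbr e (inj₁ (inj₁ e≡0))          = inj₁ (Fin.toℕ-injective (sym e≡0))
      head-CycNbr e (inj₂ (inj₁ (_ , e-last))) =
        inj₂ (Fin.toℕ-injective (trans (ℕ.suc-injective e-last) (sym (Fin.toℕ-fromℕ (3 + M)))))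

      head-PathNbr : ∀ e → PathNbr {k} fzero (fsuc e) → fsuc e ≡ first
      head-PathNbr e (inj₁ e≡0) = Fin.toℕ-injective (sym e≡0)

      ¬CycNbr-self : ¬ CycNbr {k} fzero fzero
      ¬CycNbr-self (inj₁ (inj₁ ()))
      ¬CycNbr-self (inj₁ (inj₂ ()))
      ¬CycNbr-self (inj₂ (inj₁ (_ , ())))
      ¬CycNbr-self (inj₂ (inj₂ (_ , ())))

    head-nbrs : ∀ {c} e → Merged h⁺ c (w fzero) → Adj h c (w (fsuc e)) → fsuc e ≡ first ⊎ fsuc e ≡ last
    head-nbrs e c~w₀ c-we =
      head-CycNbr e (Equivalence.to (adj fzero (fsuc e)) (Adj-resp-Merged c~w₀ m-refl (Adj-mono (⊆-∷ʳ h _) c-we)))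

    tail-adj : ∀ e e′ → Adj h (w (fsuc e)) (w (fsuc e′)) ⇔ CycNbr (fsuc e) (fsuc e′)
    tail-adj e e′ = mk⇔ (Equivalence.to (adj _ _) ∘ Adj-mono (⊆-∷ʳ h _))
                        (Adj-∷ʳ-true-off (x≉tail e) (x≉tail e′) ∘ Equivalence.from (adj _ _))

    replaced-distinct : ∀ {c} → Merged h⁺ c (w fzero) → Distinct h (c ∷ tail w)
    replaced-distinct c~w₀ fzero    fzero    0≢0  = ⊥-elim (0≢0 refl)
    replaced-distinct c~w₀ fzero    (fsuc e) _    =
      distinct fzero (fsuc e) (λ ()) ∘ m-trans (m-sym c~w₀) ∘ Merged-mono (⊆-∷ʳ h _)
    replaced-distinct c~w₀ (fsuc e) fzero    _    =
      distinct fzero (fsuc e) (λ ()) ∘ m-trans (m-sym c~w₀) ∘ Merged-mono (⊆-∷ʳ h _) ∘ m-sym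
    replaced-distinct c~w₀ (fsuc e) (fsuc e′) e≢e′ = distinct (fsuc e) (fsuc e′) e≢e′ ∘ Merged-mono (⊆-∷ʳ h _)

    replaced-cycle : ∀ {c} → Merged h⁺ c (w fzero) → Adj h c (w first) → Adj h c (w last) → InducedCycle h k (c ∷ tail w)
    replaced-cycle {c} c~w₀ c-w₁ c-wₗ = replaced-distinct c~w₀ , cycle-adj
      where
      to-head : ∀ e → Adj h c (w (fsuc e)) → CycNbr fzero (fsuc e)
      to-head e = Equivalence.to (adj fzero (fsuc e)) ∘ Adj-resp-Merged c~w₀ m-refl ∘ Adj-mono (⊆-∷ʳ h _)
      from-head : ∀ e → CycNbr fzero (fsuc e) → Adj h c (w (fsuc e))
      from-head e nbr with head-CycNbr e nbr
      ... | inj₁ refl = c-w₁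
      ... | inj₂ refl = c-wₗ
      cycle-adj : ∀ i j → Adj h ((c ∷ tail w) i) ((c ∷ tail w) j) ⇔ CycNbr i j
      cycle-adj fzero    fzero     = mk⇔ (⊥-elim ∘ loopless m-refl) (⊥-elim ∘ ¬CycNbr-self)
      cycle-adj fzero    (fsuc e)  = mk⇔ (to-head e) (from-head e)
      cycle-adj (fsuc e) fzero     = mk⇔ (CycNbr-sym ∘ to-head e ∘ Adj-sym) (Adj-sym ∘ from-head e ∘ CycNbr-sym)
      cycle-adj (fsuc e) (fsuc e′) = tail-adj e e′

    replaced-path : ∀ {c} → Merged h⁺ c (w fzero) → Adj h c (w first) → ¬ Adj h c (w last) → InducedPath h k (c ∷ tail w)
    replaced-path {c} c~w₀ c-w₁ c≁wₗ = replaced-distinct c~w₀ , path-adj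
      where
      to-head : ∀ e → Adj h c (w (fsuc e)) → PathNbr fzero (fsuc e)
      to-head e c-we with head-nbrs e c~w₀ c-we
      ... | inj₁ refl = inj₁ refl
      ... | inj₂ refl = ⊥-elim (c≁wₗ c-we)
      from-head : ∀ e → PathNbr fzero (fsuc e) → Adj h c (w (fsuc e))
      from-head e nbr with head-PathNbr e nbr
      ... | refl = c-w₁
      path-adj : ∀ i j → Adj h ((c ∷ tail w) i) ((c ∷ tail w) j) ⇔ PathNbr i j
      path-adj fzero    fzero     = mk⇔ (⊥-elim ∘ loopless m-refl) [ (λ ()) , (λ ()) ]
      path-adj fzero    (fsuc e)  = mk⇔ (to-head e) (from-head e)
      path-adj (fsuc e) fzero     = mk⇔ (PathNbr-sym ∘ to-head e ∘ Adj-sym) (Adj-sym ∘ from-head e ∘ PathNbr-sym)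
      path-adj (fsuc e) (fsuc e′) =
        ⇔.trans (tail-adj e e′) (mk⇔ [ (λ nbr → nbr) , [ (λ ()) ∘ proj₁ , (λ ()) ∘ proj₁ ] ] inj₁)

    detour : ∀ {c d} → Merged h⁺ c (w fzero) → Merged h⁺ d (w fzero) → ¬ Adj h d c → ¬ Merged h d c →
             Adj h c (w first) → ¬ Adj h c (w last) → Adj h d (w last) → ¬ Adj h d (w first) →
             InducedPathBetween h d c (suc k) (d ∷ (c ∷ tail w) ∘ opposite)
    detour {c} {d} c~w₀ d~w₀ d≁c d≉c c-w₁ c≁wₗ d-wₗ d≁w₁ =
      (fzero , refl , m-refl) ,
      (fromℕ k , cong suc (Fin.toℕ-fromℕ k) ,
        subst (λ e → Merged h ((c ∷ tail w) e) c) (sym (Fin.opposite-involutive fzero)) m-refl) ,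
      InducedPath-cons loopless (InducedPath-reverse (replaced-path c~w₀ c-w₁ c≁wₗ)) (d≉ ∘ opposite)
        (λ i → ⇔.trans (d-adj (opposite i)) (mk⇔ (cong toℕ ∘ opposite-injective) (cong opposite ∘ Fin.toℕ-injective)))
      where
      d≉ : ∀ e → ¬ Merged h d ((c ∷ tail w) e)
      d≉ fzero    = d≉c
      d≉ (fsuc e) = distinct fzero (fsuc e) (λ ()) ∘ m-trans (m-sym d~w₀) ∘ Merged-mono (⊆-∷ʳ h _)
      d-adj : ∀ e → Adj h d ((c ∷ tail w) e) ⇔ e ≡ last
      d-adj fzero    = mk⇔ (⊥-elim ∘ d≁c) (λ ())
      d-adj (fsuc e) = mk⇔ to (λ { refl → d-wₗ })
        where
        to : Adj h d (w (fsuc e)) → fsuc e ≡ last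
        to d-we with head-nbrs e d~w₀ d-we
        ... | inj₁ refl = ⊥-elim (d≁w₁ d-we)
        ... | inj₂ e≡last = e≡last

    -- Each of w₁ and wₗ is adjacent to x or to y. If one of x, y is adjacent to both, it closes an induced cycle
    -- in place of w₀; otherwise x, w₁, …, wₗ, y or x, wₗ, …, w₁, y is an induced path.
    ¬¬-cycle-or-path : ¬ ¬ (∃ (InducedCycle h k) ⊎ ∃ (InducedPathBetween h x y (suc k)))
    ¬¬-cycle-or-path ¬goal =
      ¬¬-excluded-middle λ x-w₁? → ¬¬-excluded-middle λ y-w₁? → ¬¬-excluded-middle λ x-wₗ? → ¬¬-excluded-middle λ y-wₗ? →
      ¬goal (resolve x-w₁? y-w₁? x-wₗ? y-wₗ?)
      where
      to-first : Adj h x (w first) ⊎ Adj h y (w first)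
      to-first = Adj-∷ʳ-true-on x~w₀ (x≉tail fzero) (Equivalence.from (adj fzero first) (inj₁ (inj₁ refl)))
      to-last : Adj h x (w last) ⊎ Adj h y (w last)
      to-last = Adj-∷ʳ-true-on x~w₀ (x≉tail (fromℕ (2 + M)))
                  (Equivalence.from (adj fzero last) (inj₂ (inj₁ (refl , cong suc (Fin.toℕ-fromℕ (3 + M))))))
      resolve : Dec (Adj h x (w first)) → Dec (Adj h y (w first)) → Dec (Adj h x (w last)) → Dec (Adj h y (w last)) →
                ∃ (InducedCycle h k) ⊎ ∃ (InducedPathBetween h x y (suc k))
      resolve (yes x-w₁) _ (yes x-wₗ) _ = inj₁ (_ , replaced-cycle x~w₀ x-w₁ x-wₗ)
      resolve _ (yes y-w₁) _ (yes y-wₗ) = inj₁ (_ , replaced-cycle y~w₀ y-w₁ y-wₗ)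
      resolve (yes x-w₁) (no y≁w₁) (no x≁wₗ) _ =
        inj₂ (_ , InducedPathBetween-reverse
                    (detour x~w₀ y~w₀ (x≁y ∘ Adj-sym) (x≉y ∘ m-sym) x-w₁ x≁wₗ
                            ([ ⊥-elim ∘ x≁wₗ , id ]′ to-last) y≁w₁))
      resolve (no x≁w₁) _ _ (no y≁wₗ) =
        inj₂ (_ , detour y~w₀ x~w₀ x≁y x≉y ([ ⊥-elim ∘ x≁w₁ , id ]′ to-first) y≁wₗ
                         ([ id , ⊥-elim ∘ y≁wₗ ]′ to-last) x≁w₁)
      resolve (yes _) (yes _) (no x≁wₗ) (no y≁wₗ) = ⊥-elim ([ x≁wₗ , y≁wₗ ] to-last)
      resolve (no x≁w₁) (no y≁w₁) _ (yes _)     = ⊥-elim ([ x≁w₁ , y≁w₁ ] to-first)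


-- The two directions

module _ (A : ACAlgorithm n) where

  private
    H : Partition n → ℕ → History n
    H = run (next A)

  Asks : Partition n → ℕ → Fin n → Fin n → Set
  Asks p t a b = next A (H p t) ≡ just (a , b)

  query-valid : ∀ p t {a b} → Asks p t a b → ValidQuery (H p t) a b
  query-valid p t asks = subst (StepOK (H p t)) asks (legal A p t)

  run-query-answer : ∀ p t {a b} → Asks p t a b → (a , b , answer p a b) ∈ H p (suc t)
  run-query-answer p t asks =
    subst ((_ , _ , answer p _ _) ∈_) (sym (run-query (next A) p t asks)) (∈-∷ʳ (run (next A) p t) _)

  no-repeated-query : ∀ p {t t′ a b} → t < t′ → Asks p t a b → ¬ Asks p t′ a b
  no-repeated-query p {t} {t′} {a} {b} t<t′ asks asks′ with answer p a b | run-query-answer p t asks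
  ... | true  | e = proj₁ (query-valid p t′ asks′) (m-pos (run-mono (next A) p t<t′ e))
  ... | false | e = proj₂ (query-valid p t′ asks′) (Adj-of-query (run-mono (next A) p t<t′ e))

  run-terminates : ∀ p t → ¬ (∀ k → next A (H p (k + t)) ≢ nothing)
  run-terminates p t never-stops = Fin.ℕ→Fin-notInjective code code-injective
    where
    query : ∀ k → ∃[ a ] ∃[ b ] Asks p (k + t) a b
    query k with next A (H p (k + t)) in asks
    ... | just (a , b) = a , b , refl
    ... | nothing      = ⊥-elim (never-stops k asks)

    code : ℕ → Fin (n * n)
    code k = combine (proj₁ (query k)) (proj₁ (proj₂ (query k)))

    repeated : ∀ {k k′} → k < k′ → code k ≢ code k′
    repeated {k} {k′} k<k′ eq with Fin.combine-injective _ _ _ _ eq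
    ... | a≡a′ , b≡b′ = no-repeated-query p (ℕ.+-monoˡ-< t k<k′) (proj₂ (proj₂ (query k)))
                          (subst₂ (Asks p (k′ + t)) (sym a≡a′) (sym b≡b′) (proj₂ (proj₂ (query k′))))

    code-injective : ∀ {k k′} → code k ≡ code k′ → k ≡ k′
    code-injective {k} {k′} eq with ℕ.<-cmp k k′
    ... | tri< k<k′ _ _ = ⊥-elim (repeated k<k′ eq)
    ... | tri≈ _ k≡k′ _ = k≡k′
    ... | tri> _ _ k′<k = ⊥-elim (repeated k′<k (sym eq))

  run-loopless : ∀ p t → Loopless (H p t)
  run-loopless p t = Merged⇒¬Adj {p = p} (run-consistent (next A) p t)

  run-invariant : ∀ (P : History n → Set) p t₀ →
    (∀ t {a b} → Asks p t a b → P (H p t) → P (H p t ∷ʳ (a , b , answer p a b))) →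
    P (H p t₀) → ∀ k → P (H p (k + t₀))
  run-invariant P p t₀ preserved P₀ zero    = P₀
  run-invariant P p t₀ preserved P₀ (suc k) = step-case _ refl (run-invariant P p t₀ preserved P₀ k)
    where
    t = k + t₀
    step-case : ∀ o → next A (H p t) ≡ o → P (H p t) → P (H p (suc t))
    step-case nothing      stops Pt = subst P (sym (run-stop (next A) p t stops)) Pt
    step-case (just (a , b)) asks Pt = subst P (sym (run-query (next A) p t asks)) (preserved t asks Pt)

  run-vertexPartition : ∀ p t (merged? : Decidable (Merged (H p t))) → H (vertexPartition merged?) t ≡ H p t
  run-vertexPartition p t merged? = consistent⇒run≡ (next A) p t (vertexPartition-consistent merged? (run-loopless p t))

  run-query-false : ∀ p t {a b} → Asks p t a b → answer p a b ≡ false → H p (suc t) ≡ H p t ∷ʳ (a , b , false)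
  run-query-false p t {a} {b} asks ans = trans (run-query (next A) p t asks) (cong (λ x → H p t ∷ʳ (a , b , x)) ans)

  excessive⇒InducedCycle≥4 : ∀ p t {a b} → Asks p t a b → Excessive p (H p t) a b →
    ∃[ k ] ∃ (InducedCycle≥4 (H p (suc t)) k)
  excessive⇒InducedCycle≥4 p t {a} {b} asks
    (k , u , even , (i₀ , i₀≡0 , ua) , (i₁ , i₁-last , ub) , distinct , adj , β₁ , β₂ , β₁≢β₂ , colour₀ , colour₁) =
    k , u , even-InducedPathBetween⇒4≤ (proj₂ (query-valid p t asks)) path even ,
    subst (λ h → InducedCycle h k u) (sym (run-query-false p t asks different)) (InducedPathBetween⇒InducedCycle path)
    where
    path : InducedPathBetween (H p t) a b k u
    path = (i₀ , i₀≡0 , ua) , (i₁ , i₁-last , ub) , distinct , adj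
    pa≡β₁ : p a ≡ β₁
    pa≡β₁ = colour₀ i₀ a (m-sym ua) (cong (_% 2) i₀≡0)
    pb≡β₂ : p b ≡ β₂
    pb≡β₂ = colour₁ i₁ b (m-sym ub) (odd⇒%2≡1 (even-suc⇒odd (subst Even (sym i₁-last) even)))
    different : answer p a b ≡ false
    different = answer-false⁺ p a b (λ pa≡pb → β₁≢β₂ (trans (sym pa≡β₁) (trans pa≡pb pb≡β₂)))

  chordal⇒no-excessive : ChordalAlg A → NoExcessiveQueries A
  chordal⇒no-excessive chordal p t a b asks excessive with excessive⇒InducedCycle≥4 p t asks excessive
  ... | k , v , cycle = chordal p (suc t) k v cycle

  module _ (no-excessive : NoExcessiveQueries A) where

    no-even-path : ∀ p t {a b k u} → Asks p t a b → InducedPathBetween (H p t) a b k u → Even k → ⊥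
    no-even-path p t {a} {b} {k} {u} asks (start , end , distinct , adj) even = ¬¬-Merged-decidable (H p t) excessive
      where
      excessive : Decidable (Merged (H p t)) → ⊥
      excessive merged? =
        no-excessive q t a b (trans (cong (next A) same) asks)
          (subst (λ h → Excessive q h a b) (sym same)
            (k , u , even , start , end , distinct , adj , 0 , 1 , (λ ()) , colour 0 , colour 1))
        where
        q : Partition n
        q = pathPartition merged? u distinct
        same : H q t ≡ H p t
        same = consistent⇒run≡ (next A) p t
          (pathPartition-consistent merged? u distinct (run-loopless p t) (λ i j → Equivalence.to (adj i j)))
        colour : ∀ β (i : Fin k) c → Merged (H p t) c (u i) → toℕ i % 2 ≡ β → q c ≡ β
        colour β i c c~ui i≡β = trans (pathPartition-on merged? u distinct c~ui) i≡β

    no-query-across-odd-cycle : ∀ p t {K v a b} → Asks p t a b → Odd (suc K) → InducedCycle (H p t) (suc K) v →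
                                Touches (H p t) a v → Touches (H p t) b v → ⊥
    no-query-across-odd-cycle p t {K} {v} {a} {b} asks odd cycle (i , a~vi) (j , b~vj) =
      [ no-even-path p t asks (proj₂ (arc i j d i+d≡j a~vi b~vj a≁b))
      , no-even-path p t asks (InducedPathBetween-reverse (proj₂ (arc j i d′ j+d′≡i b~vj a~vi (a≁b ∘ Adj-sym))))
      ] (odd-+⇒even-suc (toℕ d) (toℕ d′) (subst Odd (sym d+d′≡L) odd))
      where
      open Rotation K
      h = H p t
      a≉b = proj₁ (query-valid p t asks)
      a≁b = proj₂ (query-valid p t asks)
      arc : ∀ {c e} i j d → rotate (toℕ i) d ≡ j → Merged h c (v i) → Merged h e (v j) → ¬ Adj h c e →
            ∃ (InducedPathBetween h c e (suc (toℕ d)))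
      arc {c} {e} i j d i+d≡j c~vi e~vj c≁e =
        _ , InducedPathBetween-resp-Merged (m-sym c~w₀) (m-sym e~wd)
              (proj₂ (InducedCycle⇒arc (InducedCycle-rotate (toℕ i) cycle) d wd≁w₀))
        where
        c~w₀ : Merged h c (v (rotate (toℕ i) fzero))
        c~w₀ = subst (λ x → Merged h c (v x)) (sym (rotate-at-zero i)) c~vi
        e~wd : Merged h e (v (rotate (toℕ i) d))
        e~wd = subst (λ x → Merged h e (v x)) (sym i+d≡j) e~vj
        wd≁w₀ : ¬ Adj h (v (rotate (toℕ i) d)) (v (rotate (toℕ i) fzero))
        wd≁w₀ = c≁e ∘ Adj-sym ∘ Adj-resp-Merged (m-sym e~wd) (m-sym c~w₀)
      d = rotate (suc K ∸ toℕ i) j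
      i+d≡j = rotate-onto i j
      d≢0 : toℕ d ≢ 0
      d≢0 d≡0 = a≉b (m-trans a~vi (m-sym (subst (λ x → Merged h b (v x)) j≡i b~vj)))
        where
        j≡i : j ≡ i
        j≡i = trans (sym i+d≡j) (trans (cong (rotate (toℕ i)) (Fin.toℕ-injective d≡0)) (rotate-at-zero i))
      complement = rotate-complement i j d i+d≡j d≢0
      d′ = proj₁ complement
      j+d′≡i = proj₁ (proj₂ complement)
      d+d′≡L = proj₂ (proj₂ complement)

    no-odd-cycle : ∀ p t {k v} → 4 ≤ k → Odd k → InducedCycle (H p t) k v → ⊥
    no-odd-cycle p t {k} {v} 4≤k odd cycle with k ∸ 4 | ℕ.m+[n∸m]≡n 4≤k
    ... | M | refl = ¬¬-Merged-decidable h completes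
      where
      h = H p t
      completes : Decidable (Merged h) → ⊥
      completes merged? = run-terminates q t never-stops
        where
        q = vertexPartition merged?
        Invariant : History n → Set
        Invariant h′ = h ⊆ h′ × (∀ {c d} → Merged h′ c d → Merged h c d) × InducedCycle h′ (4 + M) v
        preserved : ∀ t′ {a b} → Asks q t′ a b → Invariant (H q t′) → Invariant (H q t′ ∷ʳ (a , b , answer q a b))
        preserved t′ {a} {b} asks (h⊆ , back , cycle′) =
          subst (λ ans → Invariant (H q t′ ∷ʳ (a , b , ans))) (sym separated)
            (⊆-trans h⊆ (⊆-∷ʳ _ _) , back ∘ Merged-∷ʳ-false⁻ , Equivalence.from (InducedCycle-∷ʳ-false-off off) cycle′)
          where
          a≉b = proj₁ (query-valid q t′ asks)
          separated : answer q a b ≡ false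
          separated = vertexPartition-separates merged? (a≉b ∘ Merged-mono h⊆)
          off : ¬ Touches (H q t′) a v ⊎ ¬ Touches (H q t′) b v
          off with Fin.any? (λ i → merged? a (v i)) | Fin.any? (λ j → merged? b (v j))
          ... | yes (i , a~vi) | yes (j , b~vj) = ⊥-elim
                  (no-query-across-odd-cycle q t′ asks odd cycle′ (i , Merged-mono h⊆ a~vi) (j , Merged-mono h⊆ b~vj))
          ... | no ¬touch | _        = inj₁ (λ (i , a~vi) → ¬touch (i , back a~vi))
          ... | yes _     | no ¬touch = inj₂ (λ (j , b~vj) → ¬touch (j , back b~vj))
        invariant : ∀ k′ → Invariant (H q (k′ + t))
        invariant = run-invariant Invariant q t preserved
          (subst Invariant (sym (run-vertexPartition p t merged?)) ((λ e∈ → e∈) , (λ m → m) , cycle))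
        never-stops : ∀ k′ → next A (H q (k′ + t)) ≢ nothing
        never-stops k′ stops =
          InducedCycle⇒¬Complete (proj₂ (proj₂ (invariant k′)))
            (subst (StepOK (H q (k′ + t))) stops (legal A q (k′ + t)))

    no-long-path : ∀ p t {a b k u} → Asks p t a b → 4 ≤ k → InducedPathBetween (H p t) a b k u → ⊥
    no-long-path p t {a} {b} {k} {u} asks 4≤k path with even⊎odd k
    ... | inj₁ even = no-even-path p t asks path even
    ... | inj₂ odd  = ¬¬-Merged-decidable (H p t) closes-odd-cycle
      where
      closes-odd-cycle : Decidable (Merged (H p t)) → ⊥
      closes-odd-cycle merged? =
        no-odd-cycle q (suc t) 4≤k odd
          (subst (λ h → InducedCycle h k u) (sym after) (InducedPathBetween⇒InducedCycle path))
        where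
        q = vertexPartition merged?
        same = run-vertexPartition p t merged?
        asks′ : Asks q t a b
        asks′ = trans (cong (next A) same) asks
        after : H q (suc t) ≡ H p t ∷ʳ (a , b , false)
        after = trans (run-query-false q t asks′ (vertexPartition-separates merged? (proj₁ (query-valid p t asks))))
                      (cong (_∷ʳ (a , b , false)) same)

    chordal-∷ʳ-false : ∀ p t {x y} → Asks p t x y → Chordal (H p t) → Chordal (H p t ∷ʳ (x , y , false))
    chordal-∷ʳ-false p t asks chordal zero    v (() , _)
    chordal-∷ʳ-false p t {x} {y} asks chordal (suc K) v (4≤k , cycle) = ¬¬-Merged-decidable h uses-new-edge
      where
      open Rotation K
      h = H p t
      x≁y = proj₂ (query-valid p t asks)
      opened : ∀ {c e} i j → rotate 1 j ≡ i → Merged h c (v i) → Merged h e (v j) → Joins h x y (v i) (v j) →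
               InducedPathBetween h c e (suc K) (v ∘ rotate (toℕ i))
      opened {c} {e} i j j+1≡i c~vi e~vj joins =
        (fzero , refl , subst (λ z → Merged h (v z) c) (sym first) (m-sym c~vi)) ,
        (fromℕ K , cong suc (Fin.toℕ-fromℕ K) , subst (λ z → Merged h (v z) e) (sym last) (m-sym e~vj)) ,
        InducedCycle⇒InducedPath (ℕ.≤-trans (ℕ.n≤1+n 3) 4≤k) x≁y refl (cong suc (Fin.toℕ-fromℕ K))
          (subst₂ (λ i′ j′ → Joins h x y (v i′) (v j′)) (sym first) (sym last) joins) (InducedCycle-rotate (toℕ i) cycle)
        where
        first = rotate-at-zero i
        last  = rotate-last i j j+1≡i
      uses-new-edge : Decidable (Merged h) → ⊥
      uses-new-edge merged? with Fin.any? (λ i → merged? x (v i)) | Fin.any? (λ j → merged? y (v j))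
      ... | no ¬touch | _         = chordal (suc K) v (4≤k , Equivalence.to (InducedCycle-∷ʳ-false-off (inj₁ ¬touch)) cycle)
      ... | yes _     | no ¬touch = chordal (suc K) v (4≤k , Equivalence.to (InducedCycle-∷ʳ-false-off (inj₂ ¬touch)) cycle)
      ... | yes (i , x~vi) | yes (j , y~vj)
            with Equivalence.to (CycNbr⇔rotate-1 i j)
                   (Equivalence.to (proj₂ cycle i j) (Adj-∷ʳ-false⁺ (inj₁ (x~vi , y~vj))))
      ...   | inj₂ j+1≡i = no-long-path p t asks 4≤k (opened i j j+1≡i x~vi y~vj (inj₁ (x~vi , y~vj)))
      ...   | inj₁ i+1≡j = no-long-path p t asks 4≤k
                             (InducedPathBetween-reverse (opened j i i+1≡j y~vj x~vi (inj₂ (x~vi , y~vj))))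

    chordal-∷ʳ-true : ∀ p t {x y} → Asks p t x y → Chordal (H p t) → Chordal (H p t ∷ʳ (x , y , true))
    chordal-∷ʳ-true p t {x} {y} asks chordal k v (4≤k , cycle) with k ∸ 4 | ℕ.m+[n∸m]≡n 4≤k
    ... | M | refl = ¬¬-Merged-decidable h⁺ through-merged-vertex
      where
      h⁺ = H p t ∷ʳ (x , y , true)
      open Merge (proj₁ (query-valid p t asks)) (proj₂ (query-valid p t asks)) (run-loopless p t)
      open Rotation (3 + M)
      through-merged-vertex : Decidable (Merged h⁺) → ⊥
      through-merged-vertex merged? with Fin.any? (λ i → merged? x (v i))
      ... | no ¬touch      = chordal (4 + M) v (4≤k , InducedCycle-∷ʳ-true-off ¬touch cycle)
      ... | yes (i , x~vi) =
        ¬¬-cycle-or-path (InducedCycle-rotate (toℕ i) cycle)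
          (subst (λ z → Merged h⁺ x (v z)) (sym (rotate-at-zero i)) x~vi)
          [ (λ (u , cycle′) → chordal (4 + M) u (4≤k , cycle′))
          , (λ (u , path)   → no-long-path p t asks (ℕ.m≤n⇒m≤1+n 4≤k) path) ]′

    run-chordal : ∀ p t → Chordal (H p t)
    run-chordal p zero    k v (s≤s (s≤s (s≤s (s≤s _))) , _ , adj)
      with Equivalence.from (adj fzero (fsuc fzero)) (inj₁ (inj₁ refl))
    ... | _ , _ , () , _
    run-chordal p (suc t) = by-query _ refl
      where
      by-query : ∀ o → next A (H p t) ≡ o → Chordal (H p (suc t))
      by-query nothing        stops = subst Chordal (sym (run-stop (next A) p t stops)) (run-chordal p t)
      by-query (just (x , y)) asks  = subst Chordal (sym (run-query (next A) p t asks)) (by-answer _ refl)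
        where
        by-answer : ∀ b → answer p x y ≡ b → Chordal (H p t ∷ʳ (x , y , answer p x y))
        by-answer true  ans rewrite ans = chordal-∷ʳ-true p t asks (run-chordal p t)
        by-answer false ans rewrite ans = chordal-∷ʳ-false p t asks (run-chordal p t)

lemma3 : ∀ (n : ℕ) (A : ACAlgorithm n) → NoExcessiveQueries A ⇔ ChordalAlg A
lemma3 n A = mk⇔ (run-chordal A) (chordal⇒no-excessive A)
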